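{- Let $s,t\in\mathbb{R}$ with $s\neq0$, $t\neq0$ (and $s^2+4t\neq0$). For all $n\in\mathbb{N}$: \begin{enumerate} \item $\genfrac{\{}{\}}{0pt}{}{n+2}{2}_{s,t}=t\genfrac{\{}{\}}{0pt}{}{n+1}{2}_{s,t}+\{n+1\}_{s,t}^2$; \item $\genfrac{\{}{\}}{0pt}{}{n+1}{2}_{s,t}=\sum_{k=1}^{n}t^{n-k}\{k\}_{s,t}^2$. \end{enumerate}
   Context: Generalized Fibonacci polynomials: $\{0\}_{s,t}=0$, $\{1\}_{s,t}=1$, $\{n+2\}_{s,t}=s\{n+1\}_{s,t}+t\{n\}_{s,t}$. The generalized triangular numbers are $\genfrac{\{}{\}}{0pt}{}{n+1}{2}_{s,t}=\frac{\{n\}_{s,t}\{n+1\}_{s,t}}{\{2\}_{s,t}}=\frac{\{n\}_{s,t}\{n+1\}_{s,t}}{s}$. -}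

module Defs where

open import Level using (Level)
open import Data.Nat using (ℕ; zero; suc; _∸_)
open import Algebra.Bundles using (CommutativeRing)

module FibDefs {c ℓ : Level} (R : CommutativeRing c ℓ) where
  open CommutativeRing R

  fib : Carrier → Carrier → ℕ → Carrier
  fib s t zero = 0#
  fib s t (suc zero) = 1#
  fib s t (suc (suc n)) = s * fib s t (suc n) + t * fib s t n

  pow : Carrier → ℕ → Carrier
  pow x zero = 1#
  pow x (suc m) = x * pow x m

  sum1 : (ℕ → Carrier) → ℕ → Carrier
  sum1 f zero = 0#
  sum1 f (suc n) = sum1 f n + f (suc n)

  -- generalized triangular number {n+1 choose 2}_{s,t} = {n}{n+1} / {2},
  -- where {2}_{s,t} = s and division by s is multiplication by a given
  -- inverse sInv of s.
  tri : (s t sInv : Carrier) → ℕ → Carrier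
  tri s t sInv n = (fib s t n * fib s t (suc n)) * sInv

-- Since {n+2} = s{n+1} + t{n}, the numerator {n+1}{n+2} of the next triangular
-- number equals t{n}{n+1} + s{n+1}², so dividing by s gives the recurrence
-- T(n+1) = t T(n) + {n+1}² with T(0) = 0; unrolling this first-order linear
-- recurrence yields the weighted sum of squares.
module Submission where

open import Defs
open import Level using (Level)
open import Data.Nat using (ℕ; zero; suc; _∸_; _≤_)
open import Data.Nat.Properties using (≤-refl; m≤n⇒m≤1+n; n∸n≡0; +-∸-assoc)
open import Data.Product using (_×_; _,_)
open import Relation.Nullary using (¬_)
open import Algebra.Bundles using (CommutativeRing)
import Algebra.Solver.Ring.NaturalCoefficients.Default as NaturalSolver
open import Relation.Binary.PropositionalEquality as ≡ using (_≡_)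

module FibProperties {c ℓ : Level} (R : CommutativeRing c ℓ) where
  open CommutativeRing R
  open FibDefs R
  open NaturalSolver commutativeSemiring
  open import Relation.Binary.Reasoning.Setoid setoid

  sum1-cong : ∀ {f g : ℕ → Carrier} n → (∀ {k} → k ≤ n → f k ≈ g k) →
              sum1 f n ≈ sum1 g n
  sum1-cong zero    f≈g = refl
  sum1-cong (suc n) f≈g = +-cong (sum1-cong n (λ k≤n → f≈g (m≤n⇒m≤1+n k≤n))) (f≈g ≤-refl)

  *-distribˡ-sum1 : ∀ x (f : ℕ → Carrier) n → x * sum1 f n ≈ sum1 (λ k → x * f k) n
  *-distribˡ-sum1 x f zero    = zeroʳ x
  *-distribˡ-sum1 x f (suc n) = trans (distribˡ x _ _) (+-congʳ (*-distribˡ-sum1 x f n))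

  pow-suc-∸ : ∀ x {n k} → k ≤ n → x * pow x (n ∸ k) ≡ pow x (suc n ∸ k)
  pow-suc-∸ x k≤n = ≡.cong (pow x) (≡.sym (+-∸-assoc 1 k≤n))

  pow-∸-self : ∀ x n → pow x (n ∸ n) ≡ 1#
  pow-∸-self x n = ≡.cong (pow x) (n∸n≡0 n)

  linear-recurrence-unfold : ∀ (t : Carrier) (g a : ℕ → Carrier) →
    a 0 ≈ 0# → (∀ n → a (suc n) ≈ t * a n + g (suc n)) →
    ∀ n → a n ≈ sum1 (λ k → pow t (n ∸ k) * g k) n
  linear-recurrence-unfold t g a a₀ step zero    = a₀
  linear-recurrence-unfold t g a a₀ step (suc n) = begin
      a (suc n)
    ≈⟨ step n ⟩
      t * a n + g (suc n)
    ≈⟨ +-congʳ (*-congˡ (linear-recurrence-unfold t g a a₀ step n)) ⟩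
      t * sum1 (λ k → pow t (n ∸ k) * g k) n + g (suc n)
    ≈⟨ +-cong (*-distribˡ-sum1 t _ n) (sym (*-identityˡ _)) ⟩
      sum1 (λ k → t * (pow t (n ∸ k) * g k)) n + 1# * g (suc n)
    ≈⟨ +-cong (sum1-cong n weight-shift) (*-congʳ (reflexive (≡.sym (pow-∸-self t n)))) ⟩
      sum1 (λ k → pow t (suc n ∸ k) * g k) n + pow t (suc n ∸ suc n) * g (suc n)
    ∎
    where
    weight-shift : ∀ {k} → k ≤ n → t * (pow t (n ∸ k) * g k) ≈ pow t (suc n ∸ k) * g k
    weight-shift k≤n = trans (sym (*-assoc _ _ _)) (*-congʳ (reflexive (pow-suc-∸ t k≤n)))

  tri-zero : ∀ s t sInv → tri s t sInv 0 ≈ 0#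
  tri-zero s t sInv = trans (*-congʳ (zeroˡ 1#)) (zeroˡ sInv)

  tri-suc : ∀ s t sInv → s * sInv ≈ 1# → ∀ n →
    tri s t sInv (suc n) ≈ t * tri s t sInv n + fib s t (suc n) * fib s t (suc n)
  tri-suc s t sInv s*sInv≈1 n = begin
      (b * (s * b + t * a)) * sInv
    ≈⟨ solve 5 (λ a b s t i → (b :* (s :* b :+ t :* a)) :* i
                            := t :* ((a :* b) :* i) :+ (b :* b) :* (s :* i))
             refl a b s t sInv ⟩
      t * ((a * b) * sInv) + (b * b) * (s * sInv)
    ≈⟨ +-congˡ (trans (*-congˡ s*sInv≈1) (*-identityʳ _)) ⟩
      t * ((a * b) * sInv) + b * b
    ∎
    where
    a = fib s t n
    b = fib s t (suc n)

mainTheorem11 : {c ℓ : Level} (R : CommutativeRing c ℓ) →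
    let open CommutativeRing R
        open FibDefs R
    in (s t sInv : Carrier) →
       ¬ (s ≈ 0#) → s * sInv ≈ 1# → ¬ (t ≈ 0#) →
       ¬ ((s * s + (1# + 1# + 1# + 1#) * t) ≈ 0#) →
       (n : ℕ) →
         (tri s t sInv (suc n) ≈ t * tri s t sInv n + fib s t (suc n) * fib s t (suc n))
         × (tri s t sInv n ≈ sum1 (λ k → pow t (n ∸ k) * (fib s t k * fib s t k)) n)
mainTheorem11 R s t sInv _ s*sInv≈1 _ _ n =
    tri-suc s t sInv s*sInv≈1 n
  , linear-recurrence-unfold t (λ k → fib s t k * fib s t k) (tri s t sInv)
      (tri-zero s t sInv) (tri-suc s t sInv s*sInv≈1) n
  where
  open CommutativeRing R
  open FibDefs R
  open FibProperties R
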